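{- For integers $x\le y$ write $[x,y]=\{n\in\mathbb{Z}: x\le n\le y\}$. For $k\ge 1$ let \[ c_k=4\cdot 5^{k-1},\qquad B_k=[5\cdot 5^{k-1},\,6\cdot 5^{k-1}-1],\qquad F_k=[10\cdot 5^{k-1}-1,\,15\cdot 5^{k-1}], \] and let \[ A=[2,3]\cup\bigcup_{k\ge 1}\bigl(\{c_k\}\cup B_k\cup F_k\bigr). \] For each $k\ge 1$ define $J_k=[9\cdot 5^{k-1},\,10\cdot 5^{k-1}-1]$. If $n\in J_k$ and $n=a+b$ with $a,b\in A$, then one of $a,b$ equals $c_k$ and the other lies in $B_k$. -}

module Defs where

open import Data.Nat using (ℕ; suc) renaming (_^_ to _^ℕ_)
open import Data.Integer using (ℤ; +_; _+_; _-_; _*_; _≤_)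
open import Data.Product using (_×_; ∃)
open import Data.Sum using (_⊎_)
open import Relation.Binary.PropositionalEquality using (_≡_)

_∈[_,_] : ℤ → ℤ → ℤ → Set
n ∈[ x , y ] = (x ≤ n) × (n ≤ y)

-- 5^(k-1) as an integer, for k ≥ 1 (k = suc m gives 5^m)
pow5 : (k : ℕ) → ℤ
pow5 0 = + 1  -- unused: k ≥ 1 is always enforced where pow5 is used
pow5 (suc m) = + (5 ^ℕ m)

c : ℕ → ℤ
c k = + 4 * pow5 k

InB : ℕ → ℤ → Set
InB k n = n ∈[ + 5 * pow5 k , + 6 * pow5 k - + 1 ]

InF : ℕ → ℤ → Set
InF k n = n ∈[ + 10 * pow5 k - + 1 , + 15 * pow5 k ]

InJ : ℕ → ℤ → Set
InJ k n = n ∈[ + 9 * pow5 k , + 10 * pow5 k - + 1 ]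

InA : ℤ → Set
InA n = n ∈[ + 2 , + 3 ]
      ⊎ ∃ λ (m : ℕ) → let k = suc m in (n ≡ c k) ⊎ InB k n ⊎ InF k n

{-# OPTIONS --safe #-}
module Submission where

-- Measure everything in units of Q = 5^(k-1). An element of A from a lower level j < k lies in
-- [4·5^(j-1), 15·5^(j-1)], so it is at most 3Q; one from a higher level is at least 4·5^(j-1) ≥ 20Q.
-- Hence every a ∈ A satisfies a ≤ 3Q, a = c_k = 4Q, a ∈ B_k = [5Q, 6Q - 1], or a ≥ 10Q - 1.
-- In a sum a + b ∈ J_k = [9Q, 10Q - 1] of positive summands neither summand is ≥ 10Q - 1, so
-- both are ≤ 6Q - 1, so neither is ≤ 3Q; finally 4Q + 4Q < 9Q and two elements of B_k sum to ≥ 10Q.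

open import Defs
open import Data.Nat using (ℕ; _≥_; zero; suc; s≤s; z≤n)
open import Data.Integer using (ℤ; _+_)
open import Data.Product using (_×_; _,_; proj₁; proj₂)
open import Data.Sum using (_⊎_; inj₁; inj₂)
open import Relation.Binary.PropositionalEquality using (_≡_; refl; sym; subst; cong)

import Data.Nat as ℕ
import Data.Nat.Properties as ℕ
open import Data.Integer.Base
  using (+_; -_; _-_; _*_; _≤_; _<_; 0ℤ; -1ℤ; +≤+; +<+; Positive; NonNegative; positive; nonNegative)
open import Data.Integer.Properties
  using (≤-refl; ≤-trans; <-≤-trans; <⇒≤; <⇒≱; +-comm; +-assoc; +-identityʳ; +-mono-≤; +-monoʳ-<;
         *-assoc; *-distribʳ-+; *-monoʳ-≤-nonNeg; *-monoˡ-≤-nonNeg; *-monoʳ-<-pos; *-monoˡ-<-pos;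
         pos-*; i≤j⇒i-k≤j; i≤pred[j]⇒i<j; i<j⇒i≤pred[j]; i<j⇒suc[i]≤j; module ≤-Reasoning)
open import Data.Empty using (⊥-elim)
open import Relation.Binary.Definitions using (tri<; tri≈; tri>)
open import Relation.Nullary.Decidable using (True; toWitness)

i≤j-1⇒i<j : ∀ {i j} → i ≤ j - + 1 → i < j
i≤j-1⇒i<j {i} {j} i≤j-1 = i≤pred[j]⇒i<j (subst (i ≤_) (+-comm j -1ℤ) i≤j-1)

i<j⇒i≤j-1 : ∀ {i j} → i < j → i ≤ j - + 1
i<j⇒i≤j-1 {i} {j} i<j = subst (i ≤_) (+-comm -1ℤ j) (i<j⇒i≤pred[j] i<j)

module Multiples {q : ℤ} (0<q : 0ℤ < q) where
  private instance
    q-positive : Positive q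
    q-positive = positive 0<q
    q-nonNegative : NonNegative q
    q-nonNegative = nonNegative (<⇒≤ 0<q)

  scale-≤ : ∀ m n {m≤n : True (m ℕ.≤? n)} → + m * q ≤ + n * q
  scale-≤ m n {m≤n} = *-monoʳ-≤-nonNeg q (+≤+ (toWitness m≤n))

  scale-<⇒≤-1 : ∀ m n {m<n : True (m ℕ.<? n)} → + m * q ≤ + n * q - + 1
  scale-<⇒≤-1 m n {m<n} = i<j⇒i≤j-1 (*-monoʳ-<-pos q (+<+ (toWitness m<n)))

  scale-+ : ∀ m n → + m * q + + n * q ≡ + (m ℕ.+ n) * q
  scale-+ m n = sym (*-distribʳ-+ q (+ m) (+ n))

pow5-positive : ∀ k → 0ℤ < pow5 k
pow5-positive zero    = +<+ (s≤s z≤n)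
pow5-positive (suc m) = +<+ (ℕ.m^n>0 5 m)

pow5-step : ∀ {i j} → i ℕ.< j → + 5 * pow5 (suc i) ≤ pow5 (suc j)
pow5-step {i} {j} i<j = subst (_≤ pow5 (suc j)) (pos-* 5 (5 ℕ.^ i)) (+≤+ (ℕ.^-monoʳ-≤ 5 i<j))

InLevel : ℕ → ℤ → Set
InLevel k a = (a ≡ c k) ⊎ InB k a ⊎ InF k a

module _ (k : ℕ) where
  open Multiples (pow5-positive k)

  level-bounds : ∀ {a} → InLevel k a → a ∈[ + 4 * pow5 k , + 15 * pow5 k ]
  level-bounds (inj₁ refl)             = ≤-refl , scale-≤ 4 15
  level-bounds (inj₂ (inj₁ (lo , hi))) = ≤-trans (scale-≤ 4 5) lo , ≤-trans hi (i≤j⇒i-k≤j (+ 1) (scale-≤ 6 15))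
  level-bounds (inj₂ (inj₂ (lo , hi))) = ≤-trans (scale-<⇒≤-1 4 10) lo , hi

InLevel-positive : ∀ k {a} → InLevel k a → 0ℤ < a
InLevel-positive k a∈ = <-≤-trans (*-monoˡ-<-pos (+ 4) (pow5-positive k)) (proj₁ (level-bounds k a∈))

InA-positive : ∀ {a} → InA a → 0ℤ < a
InA-positive (inj₁ (2≤a , _)) = <-≤-trans (+<+ (s≤s z≤n)) 2≤a
InA-positive (inj₂ (j , a∈))  = InLevel-positive (suc j) a∈

below-level : ∀ {i j a} → i ℕ.< j → InLevel (suc i) a → a ≤ + 3 * pow5 (suc j)
below-level {i} {j} {a} i<j a∈ = begin
  a                          ≤⟨ proj₂ (level-bounds (suc i) a∈) ⟩
  + 15 * pow5 (suc i)        ≡⟨ *-assoc (+ 3) (+ 5) (pow5 (suc i)) ⟩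
  + 3 * (+ 5 * pow5 (suc i)) ≤⟨ *-monoˡ-≤-nonNeg (+ 3) (pow5-step i<j) ⟩
  + 3 * pow5 (suc j)         ∎
  where open ≤-Reasoning

above-level : ∀ {i j a} → i ℕ.< j → InLevel (suc j) a → + 10 * pow5 (suc i) - + 1 ≤ a
above-level {i} {j} {a} i<j a∈ = begin
  + 10 * pow5 (suc i) - + 1  ≤⟨ i≤j⇒i-k≤j (+ 1) ≤-refl ⟩
  + 10 * pow5 (suc i)        ≡⟨ *-assoc (+ 2) (+ 5) (pow5 (suc i)) ⟩
  + 2 * (+ 5 * pow5 (suc i)) ≤⟨ *-monoˡ-≤-nonNeg (+ 2) (pow5-step i<j) ⟩
  + 2 * pow5 (suc j)         ≤⟨ Multiples.scale-≤ (pow5-positive (suc j)) 2 4 ⟩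
  + 4 * pow5 (suc j)         ≤⟨ proj₁ (level-bounds (suc j) a∈) ⟩
  a                          ∎
  where open ≤-Reasoning

data Middle (k : ℕ) (a : ℤ) : Set where
  centre : a ≡ c k → Middle k a
  block  : InB k a → Middle k a

data Position (k : ℕ) (a : ℤ) : Set where
  below  : a ≤ + 3 * pow5 k → Position k a
  middle : Middle k a → Position k a
  above  : + 10 * pow5 k - + 1 ≤ a → Position k a

NotAbove : ℕ → ℤ → Set
NotAbove k a = a ≤ + 3 * pow5 k ⊎ Middle k a

same-level-position : ∀ {k a} → InLevel k a → Position k a
same-level-position (inj₁ a≡c)        = middle (centre a≡c)
same-level-position (inj₂ (inj₁ a∈B)) = middle (block a∈B)
same-level-position (inj₂ (inj₂ a∈F)) = above (proj₁ a∈F)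

position : ∀ m {a} → InA a → Position (suc m) a
position m (inj₁ (_ , a≤3)) =
  below (≤-trans a≤3 (*-monoˡ-≤-nonNeg (+ 3) (i<j⇒suc[i]≤j (pow5-positive (suc m)))))
position m (inj₂ (j , a∈)) with ℕ.<-cmp j m
... | tri< j<m _ _ = below (below-level j<m a∈)
... | tri≈ _ refl _ = same-level-position a∈
... | tri> _ _ m<j = above (above-level m<j a∈)

module _ (k : ℕ) where
  open Multiples (pow5-positive k)
  private
    Q : ℤ
    Q = pow5 k

  summand-not-above : ∀ {a b} → 0ℤ < b → a + b ≤ + 10 * Q - + 1 → Position k a → NotAbove k a
  summand-not-above _ _ (below a≤)  = inj₁ a≤
  summand-not-above _ _ (middle a∈) = inj₂ a∈
  summand-not-above {a} {b} 0<b a+b≤ (above ≤a) = ⊥-elim (<⇒≱ (begin-strict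
    + 10 * Q - + 1 ≤⟨ ≤a ⟩
    a              ≡⟨ +-identityʳ a ⟨
    a + 0ℤ         <⟨ +-monoʳ-< a 0<b ⟩
    a + b          ∎) a+b≤)
    where open ≤-Reasoning

  NotAbove-≤ : ∀ {a} → NotAbove k a → a ≤ + 6 * Q - + 1
  NotAbove-≤ (inj₁ a≤)              = ≤-trans a≤ (scale-<⇒≤-1 3 6)
  NotAbove-≤ (inj₂ (centre refl))   = scale-<⇒≤-1 4 6
  NotAbove-≤ (inj₂ (block (_ , ≤6))) = ≤6

  summand-middle : ∀ {a b} → b ≤ + 6 * Q - + 1 → + 9 * Q ≤ a + b → NotAbove k a → Middle k a
  summand-middle {a} {b} b≤ ≤a+b (inj₁ a≤) = ⊥-elim (<⇒≱ (i≤j-1⇒i<j (begin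
    a + b                        ≤⟨ +-mono-≤ a≤ b≤ ⟩
    + 3 * Q + (+ 6 * Q - + 1)    ≡⟨ +-assoc (+ 3 * Q) (+ 6 * Q) (- + 1) ⟨
    (+ 3 * Q + + 6 * Q) - + 1    ≡⟨ cong (_- + 1) (scale-+ 3 6) ⟩
    + 9 * Q - + 1                ∎)) ≤a+b)
    where open ≤-Reasoning
  summand-middle _ _ (inj₂ a∈) = a∈

  centre-and-block : ∀ {a b} → + 9 * Q ≤ a + b → a + b ≤ + 10 * Q - + 1 → Middle k a → Middle k b →
                     ((a ≡ c k) × InB k b) ⊎ ((b ≡ c k) × InB k a)
  centre-and-block ≤a+b _ (centre refl) (centre refl) =
    ⊥-elim (<⇒≱ (i≤j-1⇒i<j (subst (_≤ + 9 * Q - + 1) (sym (scale-+ 4 4)) (scale-<⇒≤-1 8 9))) ≤a+b)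
  centre-and-block _ _ (centre a≡c) (block b∈B) = inj₁ (a≡c , b∈B)
  centre-and-block _ _ (block a∈B) (centre b≡c) = inj₂ (b≡c , a∈B)
  centre-and-block {a} {b} _ a+b≤ (block (5Q≤a , _)) (block (5Q≤b , _)) =
    ⊥-elim (<⇒≱ (i≤j-1⇒i<j a+b≤) (subst (_≤ a + b) (scale-+ 5 5) (+-mono-≤ 5Q≤a 5Q≤b)))

lemma3p3 : (k : ℕ) → k ≥ 1 → (n a b : ℤ) → InJ k n → n ≡ a + b → InA a → InA b →
    ((a ≡ c k) × InB k b) ⊎ ((b ≡ c k) × InB k a)
lemma3p3 k@(suc m) _ n a b (9Q≤a+b , a+b≤) refl a∈A b∈A =
  centre-and-block k 9Q≤a+b a+b≤ (summand-middle k b≤ 9Q≤a+b a′) (summand-middle k a≤ 9Q≤b+a b′)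
  where
    9Q≤b+a : + 9 * pow5 k ≤ b + a
    9Q≤b+a = subst (+ 9 * pow5 k ≤_) (+-comm a b) 9Q≤a+b
    b+a≤ : b + a ≤ + 10 * pow5 k - + 1
    b+a≤ = subst (_≤ + 10 * pow5 k - + 1) (+-comm a b) a+b≤
    a′ : NotAbove k a
    a′ = summand-not-above k (InA-positive b∈A) a+b≤ (position m a∈A)
    b′ : NotAbove k b
    b′ = summand-not-above k (InA-positive a∈A) b+a≤ (position m b∈A)
    a≤ : a ≤ + 6 * pow5 k - + 1
    a≤ = NotAbove-≤ k a′
    b≤ : b ≤ + 6 * pow5 k - + 1
    b≤ = NotAbove-≤ k b′
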